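{- Let $\Gamma$ be a connected pure graph, $v_0$ a vertex of $\Gamma$, and $V$ a hemisphere of $\Gamma$. Let $\mathcal E_1\subset E(V,V)$ and $\mathcal E_2\subset E(V^c,V^c)$ be maximally nondisconnecting subsets of $\Gamma(V)$ and $\Gamma(V^c)$ respectively, and set $\mathcal E=\mathcal E_1\cup\mathcal E_2$. Let $D\in\mathbf{QD}_{v_0}(\Gamma,\mathcal E)$ be such that for each subset $S\subsetneq E(V,V^c)$ there exists a unique $D_S\in\mathbf{QD}_{v_0}(\Gamma,\mathcal E\cup S)$ with $(\mathcal E,D)\le(\mathcal E\cup S,D_S)$. Then there exists a vertex $v_1\in V(\Gamma)$ incident to every edge of $E(V,V^c)$.
   Context: Graphs are finite, loops and multiple edges allowed; pure means all weights are 0, genus $g=b_1(\Gamma)$; $\mathrm{val}(v)$ counts loops twice. For $V,W\subset V(\Gamma)$, $E(V,W)$ is the set of edges joining a vertex of $V$ to a vertex of $W$; $V^c=V(\Gamma)\setminus V$; $\Gamma(V)$ is the subgraph with vertices $V$ and edges $E(V,V)$. A hemisphere is $V\subset V(\Gamma)$ with $\Gamma(V)$ and $\Gamma(V^c)$ connected. A maximally nondisconnecting subset of a graph is the complement in its edge set of a spanning tree. For $\mathcal E\subset E(\Gamma)$, $\Gamma^{\mathcal E}$ is obtained by inserting one vertex $v_e$ in each $e\in\mathcal E$. A pseudo-divisor is $(\mathcal E,D)$ with $D\colon V(\Gamma^{\mathcal E})\to\mathbb Z$, $D(v_e)=1$ for $e\in\mathcal E$. Order: $(\mathcal E,D)\ge(\mathcal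 E',D')$ iff $\mathcal E'\subset\mathcal E$ and there is $\varphi\colon\mathcal E\setminus\mathcal E'\to V(\Gamma)$, $\varphi(e)$ an end-vertex of $e$, with $D'(v)=D(v)+|\varphi^{ -1}(v)|$ for $v\in V(\Gamma)$. With $\mu(v)=-1+\mathrm{val}(v)/2$ on $V(\Gamma)$ and $0$ on exceptional vertices, $(\mathcal E,D)$ of degree $g-1$ is $v_0$-quasistable if $D(W)-\mu(W)+\delta_W/2\ge0$ for all nonempty $W\subset V(\Gamma^{\mathcal E})$, strictly when $v_0\notin W$ ($\delta_W$ = number of edges of $\Gamma^{\mathcal E}$ between $W$ and its complement). $\mathbf{QD}_{v_0}(\Gamma)$ is the poset of these; $\mathbf{QD}_{v_0}(\Gamma,\mathcal E)=\{D:(\mathcal E,D)\in\mathbf{QD}_{v_0}(\Gamma)\}$. -}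

module Defs where

open import Data.Nat as ℕ using (ℕ; zero; suc)
open import Data.Integer as ℤ using (ℤ; +_; _-_; _≤_; _<_)
import Data.Fin.Subset
open import Data.Bool using (Bool; true; false; _∧_; _∨_; not; _xor_; if_then_else_)
open import Data.Fin using (Fin; zero; suc; _≟_)
open import Data.Fin.Subset using (Subset; _∈_; _∉_; _⊆_; _─_; Nonempty; ⁅_⁆) renaming (_-_ to _∖_)
open import Data.Vec using (lookup; tabulate)
open import Data.Product using (Σ; _×_; ∃; _,_)
open import Data.Sum using (_⊎_)
open import Relation.Nullary using (¬_)
open import Relation.Nullary.Decidable using (⌊_⌋)
open import Relation.Binary.PropositionalEquality using (_≡_)

-- Finite graphs: vertices Fin n, edges Fin m, each edge with two
-- end-vertices (loops and multiple edges allowed).  Pure: no weights.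

record Graph : Set where
  field
    n   : ℕ
    m   : ℕ
    src : Fin m → Fin n
    tgt : Fin m → Fin n

count : ∀ {k} → (Fin k → Bool) → ℕ
count {zero}  f = 0
count {suc k} f = (if f zero then 1 else 0) ℕ.+ count (λ i → f (suc i))

sumℤ : ∀ {k} → (Fin k → ℤ) → ℤ
sumℤ {zero}  f = + 0
sumℤ {suc k} f = f zero ℤ.+ sumℤ (λ i → f (suc i))

module _ (Γ : Graph) where
  open Graph Γ

  _∈ᵇ_ : ∀ {k} → Fin k → Subset k → Bool
  x ∈ᵇ p = lookup p x

  E : Subset n → Subset n → Subset m
  E V W = tabulate (λ e → (src e ∈ᵇ V ∧ tgt e ∈ᵇ W) ∨ (src e ∈ᵇ W ∧ tgt e ∈ᵇ V))

  data Reach (V : Subset n) (T : Subset m) (u : Fin n) : Fin n → Set where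
    here : Reach V T u u
    fwd  : ∀ {e} → e ∈ T → src e ∈ V → tgt e ∈ V →
           Reach V T u (src e) → Reach V T u (tgt e)
    bwd  : ∀ {e} → e ∈ T → src e ∈ V → tgt e ∈ V →
           Reach V T u (tgt e) → Reach V T u (src e)

  ConnectedOn : Subset n → Subset m → Set
  ConnectedOn V T = Nonempty V × (∀ u w → u ∈ V → w ∈ V → Reach V T u w)

  InducedConnected : Subset n → Set
  InducedConnected V = ConnectedOn V (E V V)

  Connected : Set
  Connected = InducedConnected Data.Fin.Subset.⊤

  Hemisphere : Subset n → Set
  Hemisphere V = InducedConnected V × InducedConnected (Data.Fin.Subset.∁ V)

  SpanningTree : Subset n → Subset m → Set
  SpanningTree V T =
    T ⊆ E V V × ConnectedOn V T × (∀ e → e ∈ T → ¬ ConnectedOn V (T ∖ e))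

  -- 𝓔₁ is a maximally nondisconnecting subset of Γ(V): the complement
  -- in E(V,V) of a spanning tree of Γ(V).
  MaxNondisconnecting : Subset n → Subset m → Set
  MaxNondisconnecting V 𝓔₁ = ∃ λ T → SpanningTree V T × 𝓔₁ ≡ E V V ─ T

  -- valence (loops counted twice)
  val : Fin n → ℕ
  val v = count (λ e → ⌊ src e ≟ v ⌋) ℕ.+ count (λ e → ⌊ tgt e ≟ v ⌋)

  genus : ℤ
  genus = + m - + n ℤ.+ + 1

  -- Pseudo-divisors (𝓔 , D).  D is recorded by its values on V(Γ)
  -- (D : Fin n → ℤ); its value on each exceptional vertex v_e (e ∈ 𝓔)
  -- is 1 by definition.
  --
  -- A subset W of V(Γ^𝓔) is a pair (Wv , We) with Wv ⊆ V(Γ) and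
  -- We ⊆ 𝓔 (the exceptional vertices v_e, e ∈ We).

  degW : (𝓔 : Subset m) → (Fin n → ℤ) → Subset n → Subset m → ℤ
  degW 𝓔 D Wv We =
    sumℤ (λ v → if v ∈ᵇ Wv then D v else + 0) ℤ.+ + count (λ e → e ∈ᵇ We)

  -- 2 μ(W)   (μ(v) = -1 + val(v)/2, μ(v_e) = 0)
  twoμW : Subset n → ℤ
  twoμW Wv = sumℤ (λ v → if v ∈ᵇ Wv then + val v - + 2 else + 0)

  -- δ_W : number of edges of Γ^𝓔 between W and its complement.
  -- An edge e ∉ 𝓔 stays an edge src e — tgt e; an edge e ∈ 𝓔 becomes
  -- two edges src e — v_e and v_e — tgt e.
  δW : (𝓔 : Subset m) → Subset n → Subset m → ℕ
  δW 𝓔 Wv We =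
    count (λ e → not (e ∈ᵇ 𝓔) ∧ (src e ∈ᵇ Wv xor tgt e ∈ᵇ Wv))
    ℕ.+ count (λ e → e ∈ᵇ 𝓔 ∧ (src e ∈ᵇ Wv xor e ∈ᵇ We))
    ℕ.+ count (λ e → e ∈ᵇ 𝓔 ∧ (tgt e ∈ᵇ Wv xor e ∈ᵇ We))

  deg : Subset m → (Fin n → ℤ) → ℤ
  deg 𝓔 D = sumℤ D ℤ.+ + count (λ e → e ∈ᵇ 𝓔)

  -- (𝓔 , D) is v₀-quasistable (of degree g - 1).  The inequality
  -- D(W) - μ(W) + δ_W/2 ≥ 0 is multiplied by 2.
  QD : Fin n → Subset m → (Fin n → ℤ) → Set
  QD v₀ 𝓔 D =
    deg 𝓔 D ≡ genus - + 1 ×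
    (∀ (Wv : Subset n) (We : Subset m) → We ⊆ 𝓔 → (Nonempty Wv ⊎ Nonempty We) →
       let q = (+ 2 ℤ.* degW 𝓔 D Wv We) - twoμW Wv ℤ.+ + δW 𝓔 Wv We in
       (+ 0 ≤ q) × (v₀ ∉ Wv → + 0 < q))

  _,_≼_,_ : Subset m → (Fin n → ℤ) → Subset m → (Fin n → ℤ) → Set
  𝓔 , D ≼ 𝓔' , D' =
    𝓔 ⊆ 𝓔' ×
    (∃ λ (φ : Fin m → Fin n) →
       (∀ e → e ∈ 𝓔' → e ∉ 𝓔 → φ e ≡ src e ⊎ φ e ≡ tgt e) ×
       (∀ v → D v ≡ D' v ℤ.+ + count (λ e → e ∈ᵇ 𝓔' ∧ not (e ∈ᵇ 𝓔) ∧ ⌊ φ e ≟ v ⌋)))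

-- Let F = E(V, Vᶜ) and 𝓔 = 𝓔₁ ∪ 𝓔₂. For e ∈ F, every edge outside 𝓔 ∪ (F - e) lies in one of the
-- two spanning trees or is e, so there are fewer such edges than vertices. A v₀-quasistable D′ on
-- 𝓔 ∪ (F - e) satisfies D′ ≥ -χ(v₀) (test quasistability on single vertices), while deg = g - 1 forces
-- Σ (D′ + χ(v₀)) ≤ 0; hence D′ = -χ(v₀), independently of e.
-- For distinct e, e′ ∈ F, move the chip of D_{F-e} on v_{e′}, and that of D_{F-e′} on v_e, to the
-- end-vertex chosen by the order relation. Both results are quasistable above (𝓔, D) on 𝓔 ∪ (F - e - e′),
-- so they coincide; as D_{F-e} = D_{F-e′}, the two chips sit on one vertex, common to e and e′.
-- Finally, pairwise adjacent edges joining V to Vᶜ cannot form a triangle, so they share a vertex.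

{-# OPTIONS --safe #-}
module Submission where

open import Defs
open import Data.Bool using (Bool; true; false; _∧_; _∨_; not; _xor_; if_then_else_)
import Data.Bool.Properties as Bool
open import Data.Empty using (⊥; ⊥-elim)
open import Data.Fin using (Fin; zero; suc; _≟_)
open import Data.Fin.Properties using (suc-injective; any?; all?; ¬∀⟶∃¬)
open import Data.Fin.Subset using (Subset; _∈_; _∉_; _⊆_; _⊂_; _─_; _-_; _∪_; ∁; ⁅_⁆; Nonempty) renaming (⊥ to ∅)
import Data.Fin.Subset.Properties as FSP
open import Data.Integer as ℤ using (ℤ; +_; -[1+_]; +≤+; +<+)
import Data.Integer.Properties as ℤP
open import Data.Integer.Tactic.RingSolver using (solve-∀)
open import Data.Nat as ℕ using (ℕ; zero; suc; z≤n; s≤s)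
import Data.Nat.Properties as ℕP
open import Data.Product using (Σ; _×_; _,_; proj₁; proj₂; ∃)
open import Data.Sum using (_⊎_; inj₁; inj₂)
import Data.Sum as Sum
open import Data.Vec using (lookup; tabulate; _∷_)
import Data.Vec.Properties as VP
open import Function using (_∘_)
open import Relation.Binary.PropositionalEquality
open import Relation.Nullary using (¬_)
open import Relation.Nullary.Decidable
  using (Dec; yes; no; does; ⌊_⌋; _⊎-dec_; _→-dec_; dec-true; dec-false; decidable-stable; ¬¬-excluded-middle)
import Algebra.Properties.CommutativeSemigroup
open import Algebra.Properties.AbelianGroup ℤP.+-0-abelianGroup using (∙-cancelˡ; ∙-cancelʳ)
open import Algebra.Properties.CommutativeMonoid.Sum ℕP.+-0-commutativeMonoid using (sum; ∑-distrib-+; sum-cong-≗)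

module ℕ+ = Algebra.Properties.CommutativeSemigroup ℕP.+-commutativeSemigroup
module ℤ+ = Algebra.Properties.CommutativeSemigroup ℤP.+-commutativeSemigroup

bit : Bool → ℕ
bit b = if b then 1 else 0

≟-refl : ∀ {k} (x : Fin k) → ⌊ x ≟ x ⌋ ≡ true
≟-refl x with x ≟ x
... | yes _ = refl
... | no x≢x = ⊥-elim (x≢x refl)

≟-≢ : ∀ {k} {x y : Fin k} → x ≢ y → ⌊ x ≟ y ⌋ ≡ false
≟-≢ {x = x} {y} x≢y with x ≟ y
... | yes x≡y = ⊥-elim (x≢y x≡y)
... | no _ = refl

case-true : ∀ {A : Set} → true ≡ false → A
case-true ()

∨-true : ∀ {x y} → (x ∨ y) ≡ true → x ≡ true ⊎ y ≡ true
∨-true {true} _ = inj₁ refl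
∨-true {false} y≡true = inj₂ y≡true

≢-≢⇒≡ : ∀ {a b c : Bool} → a ≢ b → b ≢ c → a ≡ c
≢-≢⇒≡ {true} {true} a≢b _ = ⊥-elim (a≢b refl)
≢-≢⇒≡ {false} {false} a≢b _ = ⊥-elim (a≢b refl)
≢-≢⇒≡ {true} {false} {true} _ _ = refl
≢-≢⇒≡ {true} {false} {false} _ b≢c = ⊥-elim (b≢c refl)
≢-≢⇒≡ {false} {true} {true} _ b≢c = ⊥-elim (b≢c refl)
≢-≢⇒≡ {false} {true} {false} _ _ = refl

does-true : ∀ {A : Set} (a? : Dec A) → does a? ≡ true → A
does-true (yes a) _ = a

¬¬-decideAll : ∀ {k} (P : Fin k → Set) → ¬ ¬ (∀ i → Dec (P i))
¬¬-decideAll {zero} P ¬dec = ¬dec λ ()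
¬¬-decideAll {suc k} P ¬dec =
  ¬¬-excluded-middle λ d₀ → ¬¬-decideAll (P ∘ suc) λ ds → ¬dec λ { zero → d₀ ; (suc i) → ds i }

bit-mono : ∀ {a b} → (a ≡ true → b ≡ true) → bit a ℕ.≤ bit b
bit-mono {false} _ = z≤n
bit-mono {true} a⇒b rewrite a⇒b refl = ℕP.≤-refl

bit-∨ : ∀ a b → bit (a ∨ b) ℕ.≤ bit a ℕ.+ bit b
bit-∨ true b = s≤s z≤n
bit-∨ false b = ℕP.≤-refl

count-cong : ∀ {k} {f g : Fin k → Bool} → (∀ i → f i ≡ g i) → count f ≡ count g
count-cong {zero} _ = refl
count-cong {suc k} f≗g = cong₂ ℕ._+_ (cong bit (f≗g zero)) (count-cong (f≗g ∘ suc))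

count-mono : ∀ {k} {f g : Fin k → Bool} → (∀ i → f i ≡ true → g i ≡ true) → count f ℕ.≤ count g
count-mono {zero} _ = z≤n
count-mono {suc k} f⇒g = ℕP.+-mono-≤ (bit-mono (f⇒g zero)) (count-mono (f⇒g ∘ suc))

count-none : ∀ {k} {f : Fin k → Bool} → (∀ i → f i ≡ false) → count f ≡ 0
count-none {zero} _ = refl
count-none {suc k} none rewrite none zero = count-none (none ∘ suc)

count-pos : ∀ {k} (f : Fin k → Bool) j → f j ≡ true → 0 ℕ.< count f
count-pos f zero fj rewrite fj = s≤s z≤n
count-pos f (suc j) fj = ℕP.≤-trans (count-pos (f ∘ suc) j fj) (ℕP.m≤n+m _ _)

count-∨ : ∀ {k} (f g : Fin k → Bool) → count (λ i → f i ∨ g i) ℕ.≤ count f ℕ.+ count g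
count-∨ {zero} f g = z≤n
count-∨ {suc k} f g =
  ℕP.≤-trans (ℕP.+-mono-≤ (bit-∨ (f zero) (g zero)) (count-∨ (f ∘ suc) (g ∘ suc)))
             (ℕP.≤-reflexive (ℕ+.interchange (bit (f zero)) (bit (g zero)) _ _))

count-split : ∀ {k} (f g : Fin k → Bool) →
  count f ≡ count (λ i → f i ∧ g i) ℕ.+ count (λ i → f i ∧ not (g i))
count-split {zero} f g = refl
count-split {suc k} f g with f zero | g zero
... | true  | true  = cong suc (count-split (f ∘ suc) (g ∘ suc))
... | true  | false = trans (cong suc (count-split (f ∘ suc) (g ∘ suc))) (sym (ℕP.+-suc _ _))
... | false | _     = count-split (f ∘ suc) (g ∘ suc)

count-complement : ∀ {k} (f : Fin k → Bool) → count f ℕ.+ count (not ∘ f) ≡ k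
count-complement {zero} f = refl
count-complement {suc k} f with f zero
... | true  = cong suc (count-complement (f ∘ suc))
... | false = trans (ℕP.+-suc _ _) (cong suc (count-complement (f ∘ suc)))

count-insert : ∀ {k} (f g : Fin k → Bool) j → (∀ i → i ≢ j → f i ≡ g i) → f j ≡ false →
  count g ≡ count f ℕ.+ bit (g j)
count-insert f g zero agree fj rewrite fj =
  trans (ℕP.+-comm (bit (g zero)) _) (cong (ℕ._+ bit (g zero)) (count-cong (λ i → sym (agree (suc i) λ ()))))
count-insert f g (suc j) agree fj rewrite agree zero (λ ()) =
  trans (cong (bit (g zero) ℕ.+_) (count-insert (f ∘ suc) (g ∘ suc) j (λ i i≢j → agree (suc i) (i≢j ∘ suc-injective)) fj))
        (sym (ℕP.+-assoc (bit (g zero)) _ _))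

count-≟ : ∀ {k} (j : Fin k) → count (λ i → ⌊ i ≟ j ⌋) ≡ 1
count-≟ {k} j = begin
  count (λ i → ⌊ i ≟ j ⌋)
    ≡⟨ count-insert (λ _ → false) (λ i → ⌊ i ≟ j ⌋) j (λ i i≢j → sym (≟-≢ i≢j)) refl ⟩
  count {k} (λ _ → false) ℕ.+ bit ⌊ j ≟ j ⌋
    ≡⟨ cong₂ (λ c b → c ℕ.+ bit b) (count-none {k} λ _ → refl) (≟-refl j) ⟩
  1 ∎
  where open ≡-Reasoning

count≡∑ : ∀ {k} (f : Fin k → Bool) → count f ≡ sum (bit ∘ f)
count≡∑ {zero} f = refl
count≡∑ {suc k} f = cong (bit (f zero) ℕ.+_) (count≡∑ (f ∘ suc))

∑-mono : ∀ {k} {F G : Fin k → ℕ} → (∀ i → F i ℕ.≤ G i) → sum F ℕ.≤ sum G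
∑-mono {zero} _ = z≤n
∑-mono {suc k} F≤G = ℕP.+-mono-≤ (F≤G zero) (∑-mono (F≤G ∘ suc))

sumℤ-cong : ∀ {k} {f g : Fin k → ℤ} → (∀ i → f i ≡ g i) → sumℤ f ≡ sumℤ g
sumℤ-cong {zero} _ = refl
sumℤ-cong {suc k} f≗g = cong₂ ℤ._+_ (f≗g zero) (sumℤ-cong (f≗g ∘ suc))

sumℤ-+ : ∀ {k} (f g : Fin k → ℤ) → sumℤ (λ i → f i ℤ.+ g i) ≡ sumℤ f ℤ.+ sumℤ g
sumℤ-+ {zero} f g = refl
sumℤ-+ {suc k} f g =
  trans (cong (λ s → (f zero ℤ.+ g zero) ℤ.+ s) (sumℤ-+ (f ∘ suc) (g ∘ suc))) (ℤ+.interchange (f zero) (g zero) _ _)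

sumℤ-zero : ∀ {k} {f : Fin k → ℤ} → (∀ i → f i ≡ + 0) → sumℤ f ≡ + 0
sumℤ-zero {zero} _ = refl
sumℤ-zero {suc k} {f} f≡0 rewrite f≡0 zero = trans (ℤP.+-identityˡ _) (sumℤ-zero {f = f ∘ suc} (f≡0 ∘ suc))

sumℤ-concentrated : ∀ {k} (f : Fin k → ℤ) j → (∀ i → i ≢ j → f i ≡ + 0) → sumℤ f ≡ f j
sumℤ-concentrated f zero off rewrite sumℤ-zero {f = f ∘ suc} (λ i → off (suc i) λ ()) = ℤP.+-identityʳ (f zero)
sumℤ-concentrated f (suc j) off rewrite off zero (λ ()) =
  trans (ℤP.+-identityˡ _) (sumℤ-concentrated (f ∘ suc) j (λ i i≢j → off (suc i) (i≢j ∘ suc-injective)))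

i≤j+i : ∀ {i j} → + 0 ℤ.≤ j → i ℤ.≤ j ℤ.+ i
i≤j+i {j = + n} _ = ℤP.i≤j⇒i≤k+j (+ n) ℤP.≤-refl

sumℤ-nonneg : ∀ {k} {f : Fin k → ℤ} → (∀ i → + 0 ℤ.≤ f i) → + 0 ℤ.≤ sumℤ f
sumℤ-nonneg {zero} _ = ℤP.≤-refl
sumℤ-nonneg {suc k} f≥0 = ℤP.+-mono-≤ (f≥0 zero) (sumℤ-nonneg (f≥0 ∘ suc))

term≤sumℤ : ∀ {k} {f : Fin k → ℤ} → (∀ i → + 0 ℤ.≤ f i) → ∀ j → f j ℤ.≤ sumℤ f
term≤sumℤ {f = f} f≥0 zero =
  subst (f zero ℤ.≤_) (ℤP.+-comm _ (f zero)) (i≤j+i (sumℤ-nonneg (f≥0 ∘ suc)))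
term≤sumℤ f≥0 (suc j) = ℤP.≤-trans (term≤sumℤ (f≥0 ∘ suc) j) (i≤j+i (f≥0 zero))

sumℤ≤0⇒zero : ∀ {k} {f : Fin k → ℤ} → (∀ i → + 0 ℤ.≤ f i) → sumℤ f ℤ.≤ + 0 → ∀ i → f i ≡ + 0
sumℤ≤0⇒zero f≥0 sum≤0 i = ℤP.≤-antisym (ℤP.≤-trans (term≤sumℤ f≥0 i) sum≤0) (f≥0 i)

card : ∀ {k} → Subset k → ℕ
card p = count (lookup p)

∈⇒lookup : ∀ {k} {p : Subset k} {x} → x ∈ p → lookup p x ≡ true
∈⇒lookup = VP.[]=⇒lookup

lookup⇒∈ : ∀ {k} {p : Subset k} {x} → lookup p x ≡ true → x ∈ p
lookup⇒∈ {p = p} {x} = VP.lookup⇒[]= x p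

∉⇒lookup : ∀ {k} {p : Subset k} {x} → x ∉ p → lookup p x ≡ false
∉⇒lookup {p = p} {x} x∉p with lookup p x in eq
... | true = ⊥-elim (x∉p (lookup⇒∈ eq))
... | false = refl

lookup-ext : ∀ {k} {p q : Subset k} → (∀ x → lookup p x ≡ lookup q x) → p ≡ q
lookup-ext {p = p} {q} p≗q =
  trans (sym (VP.tabulate∘lookup p)) (trans (VP.tabulate-cong p≗q) (VP.tabulate∘lookup q))

lookup-∪ : ∀ {k} (p q : Subset k) x → lookup (p ∪ q) x ≡ (lookup p x ∨ lookup q x)
lookup-∪ p q x = VP.lookup-zipWith _∨_ x p q

lookup-∁ : ∀ {k} (p : Subset k) x → lookup (∁ p) x ≡ not (lookup p x)
lookup-∁ p x = VP.lookup-map x not p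

∈∁⇒lookup : ∀ {k} {p : Subset k} {x} → x ∈ ∁ p → lookup p x ≡ false
∈∁⇒lookup = ∉⇒lookup ∘ FSP.x∈∁p⇒x∉p

lookup⇒∈∁ : ∀ {k} {p : Subset k} {x} → lookup p x ≡ false → x ∈ ∁ p
lookup⇒∈∁ {p = p} {x} x∉p = lookup⇒∈ (trans (lookup-∁ p x) (cong not x∉p))

lookup-─ : ∀ {k} (p q : Subset k) x → lookup (p ─ q) x ≡ (lookup p x ∧ not (lookup q x))
lookup-─ (a ∷ p) (true ∷ q) zero = sym (Bool.∧-zeroʳ a)
lookup-─ (a ∷ p) (false ∷ q) zero = sym (Bool.∧-identityʳ a)
lookup-─ (_ ∷ p) (_ ∷ q) (suc x) = lookup-─ p q x

lookup-⁅⁆ : ∀ {k} (y x : Fin k) → lookup ⁅ y ⁆ x ≡ ⌊ x ≟ y ⌋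
lookup-⁅⁆ y x with x ≟ y
... | yes refl = ∈⇒lookup (FSP.x∈⁅x⁆ x)
... | no x≢y = ∉⇒lookup (FSP.x≢y⇒x∉⁅y⁆ x≢y)

lookup-- : ∀ {k} (p : Subset k) y x → lookup (p - y) x ≡ (lookup p x ∧ not ⌊ x ≟ y ⌋)
lookup-- p y x = trans (lookup-─ p ⁅ y ⁆ x) (cong (λ b → lookup p x ∧ not b) (lookup-⁅⁆ y x))

lookup-self : ∀ {k} (p : Subset k) x → lookup (p - x) x ≡ false
lookup-self p x = trans (lookup-- p x x) (trans (cong (λ b → lookup p x ∧ not b) (≟-refl x)) (Bool.∧-zeroʳ _))

lookup-other : ∀ {k} (p : Subset k) {x y} → x ≢ y → lookup (p - y) x ≡ lookup p x
lookup-other p x≢y = trans (lookup-- p _ _) (trans (cong (λ b → lookup p _ ∧ not b) (≟-≢ x≢y)) (Bool.∧-identityʳ _))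

x∉p-x : ∀ {k} (p : Subset k) x → x ∉ p - x
x∉p-x p x x∈ with () ← trans (sym (∈⇒lookup x∈)) (lookup-self p x)

sumℤ-⁅⁆ : ∀ {k} (g : Fin k → ℤ) v → sumℤ (λ u → if lookup ⁅ v ⁆ u then g u else + 0) ≡ g v
sumℤ-⁅⁆ g v = trans (sumℤ-concentrated (λ u → if lookup ⁅ v ⁆ u then g u else + 0) v off-v)
                    (cong (λ b → if b then g v else + 0) (∈⇒lookup (FSP.x∈⁅x⁆ v)))
  where
  off-v : ∀ u → u ≢ v → (if lookup ⁅ v ⁆ u then g u else + 0) ≡ + 0
  off-v u u≢v = cong (λ b → if b then g u else + 0) (trans (lookup-⁅⁆ v u) (≟-≢ u≢v))

card-∁ : ∀ {k} (p : Subset k) → card p ℕ.+ card (∁ p) ≡ k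
card-∁ p = trans (cong (card p ℕ.+_) (count-cong (lookup-∁ p))) (count-complement (lookup p))

card-remove : ∀ {k} {p : Subset k} {x} → x ∈ p → card p ≡ suc (card (p - x))
card-remove {p = p} {x} x∈p =
  trans (count-insert (lookup (p - x)) (lookup p) x (λ i i≢x → lookup-other p i≢x) (lookup-self p x))
        (trans (cong (λ b → card (p - x) ℕ.+ bit b) (∈⇒lookup x∈p)) (ℕP.+-comm _ 1))

x∉p⇒p∪q-x≡p∪[q-x] : ∀ {k} {p : Subset k} q {x} → x ∉ p → (p ∪ q) - x ≡ p ∪ (q - x)
x∉p⇒p∪q-x≡p∪[q-x] {p = p} q {x} x∉p = lookup-ext pointwise
  where
  pointwise : ∀ y → lookup ((p ∪ q) - x) y ≡ lookup (p ∪ (q - x)) y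
  pointwise y with y ≟ x
  ... | yes refl = begin
    lookup ((p ∪ q) - y) y    ≡⟨ lookup-self (p ∪ q) y ⟩
    false                     ≡⟨ sym (∉⇒lookup x∉p) ⟩
    lookup p y                ≡⟨ sym (Bool.∨-identityʳ _) ⟩
    lookup p y ∨ false        ≡⟨ cong (lookup p y ∨_) (sym (lookup-self q y)) ⟩
    lookup p y ∨ lookup (q - y) y ≡⟨ sym (lookup-∪ p (q - y) y) ⟩
    lookup (p ∪ (q - y)) y    ∎
    where open ≡-Reasoning
  ... | no y≢x = begin
    lookup ((p ∪ q) - x) y        ≡⟨ lookup-other (p ∪ q) y≢x ⟩
    lookup (p ∪ q) y              ≡⟨ lookup-∪ p q y ⟩
    lookup p y ∨ lookup q y       ≡⟨ cong (lookup p y ∨_) (sym (lookup-other q y≢x)) ⟩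
    lookup p y ∨ lookup (q - x) y ≡⟨ sym (lookup-∪ p (q - x) y) ⟩
    lookup (p ∪ (q - x)) y        ∎
    where open ≡-Reasoning

p⊆q⇒p-x⊆q-x : ∀ {k} {p q : Subset k} {x} → p ⊆ q → p - x ⊆ q - x
p⊆q⇒p-x⊆q-x {p = p} {q} {x} p⊆q {y} y∈p-x =
  FSP.x∈p∧x≢y⇒x∈p-y (p⊆q (FSP.p─q⊆p p ⁅ x ⁆ y∈p-x)) λ { refl → x∉p-x p y y∈p-x }

∈-tabulate⁻ : ∀ {k} {f : Fin k → Bool} {x} → x ∈ tabulate f → f x ≡ true
∈-tabulate⁻ {f = f} {x} x∈ = trans (sym (VP.lookup∘tabulate f x)) (∈⇒lookup x∈)

∈-tabulate⁺ : ∀ {k} {f : Fin k → Bool} {x} → f x ≡ true → x ∈ tabulate f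
∈-tabulate⁺ {f = f} {x} fx = lookup⇒∈ (trans (VP.lookup∘tabulate f x) fx)

tabulate-∧⊆ : ∀ {k} {p : Subset k} (g : Fin k → Bool) → tabulate (λ i → lookup p i ∧ g i) ⊆ p
tabulate-∧⊆ g x∈ = lookup⇒∈ (Bool.∧-conicalˡ _ _ (∈-tabulate⁻ x∈))

card-tabulate : ∀ {k} (f : Fin k → Bool) → card (tabulate f) ≡ count f
card-tabulate f = count-cong (VP.lookup∘tabulate f)

∧-lookup⇒∈ : ∀ {k l} {p : Subset k} {q : Subset l} {x y} → (lookup p x ∧ lookup q y) ≡ true → x ∈ p × y ∈ q
∧-lookup⇒∈ both = lookup⇒∈ (Bool.∧-conicalˡ _ _ both) , lookup⇒∈ (Bool.∧-conicalʳ _ _ both)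

∧-absorbˡ : ∀ a b → (b ≡ true → a ≡ true) → (a ∧ b) ≡ b
∧-absorbˡ a false _ = Bool.∧-zeroʳ a
∧-absorbˡ a true b⇒a = cong (_∧ true) (b⇒a refl)

χ : ∀ {k} → Fin k → Fin k → ℤ
χ p v = if ⌊ p ≟ v ⌋ then + 1 else + 0

addChip : ∀ {k} → (Fin k → ℤ) → Fin k → Fin k → ℤ
addChip D p v = D v ℤ.+ χ p v

χ-self : ∀ {k} (p : Fin k) → χ p p ≡ + 1
χ-self p = cong (λ b → if b then + 1 else + 0) (≟-refl p)

χ≡1⇒≡ : ∀ {k} {p v : Fin k} → χ p v ≡ + 1 → p ≡ v
χ≡1⇒≡ {p = p} {v} χ≡1 with p ≟ v
... | yes p≡v = p≡v
... | no _ with () ← χ≡1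

sumℤ-χ : ∀ {k} (p : Fin k) → sumℤ (χ p) ≡ + 1
sumℤ-χ p = trans (sumℤ-concentrated (χ p) p off-p) (χ-self p)
  where
  off-p : ∀ v → v ≢ p → χ p v ≡ + 0
  off-p v v≢p = cong (λ b → if b then + 1 else + 0) (≟-≢ (v≢p ∘ sym))

+bit : ∀ b → + bit b ≡ (if b then + 1 else + 0)
+bit true = refl
+bit false = refl

-- The edges of Γ^𝓔 lying over one edge of Γ that cross the boundary of W: the edge is subdivided
-- iff c, and s, t, w record whether its source, target and exceptional vertex lie in W.
edgeCut : (c s t w : Bool) → ℕ
edgeCut c s t w = bit (not c ∧ (s xor t)) ℕ.+ bit (c ∧ (s xor w)) ℕ.+ bit (c ∧ (t xor w))

edgeCut-≤ : ∀ c s t → edgeCut c s t false ℕ.≤ bit s ℕ.+ bit t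
edgeCut-≤ false false false = z≤n
edgeCut-≤ false false true = s≤s z≤n
edgeCut-≤ false true false = s≤s z≤n
edgeCut-≤ false true true = z≤n
edgeCut-≤ true false false = z≤n
edgeCut-≤ true false true = s≤s z≤n
edgeCut-≤ true true false = s≤s z≤n
edgeCut-≤ true true true = ℕP.≤-refl

edgeCut-subdivide : ∀ {s t w} → w ≡ s ⊎ w ≡ t → edgeCut false s t false ≡ edgeCut true s t w
edgeCut-subdivide {false} {false} (inj₁ refl) = refl
edgeCut-subdivide {false} {true} (inj₁ refl) = refl
edgeCut-subdivide {true} {false} (inj₁ refl) = refl
edgeCut-subdivide {true} {true} (inj₁ refl) = refl
edgeCut-subdivide {false} {false} (inj₂ refl) = refl
edgeCut-subdivide {false} {true} (inj₂ refl) = refl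
edgeCut-subdivide {true} {false} (inj₂ refl) = refl
edgeCut-subdivide {true} {true} (inj₂ refl) = refl

-- Spanning trees, quasistability and stars in a graph

module _ (Γ : Graph) where
  open Graph Γ

  Reach-trans : ∀ {V T u v w} → Reach Γ V T u v → Reach Γ V T v w → Reach Γ V T u w
  Reach-trans r here = r
  Reach-trans r (fwd e∈T s∈V t∈V r′) = fwd e∈T s∈V t∈V (Reach-trans r r′)
  Reach-trans r (bwd e∈T s∈V t∈V r′) = bwd e∈T s∈V t∈V (Reach-trans r r′)

  Reach-sym : ∀ {V T u w} → Reach Γ V T u w → Reach Γ V T w u
  Reach-sym here = here
  Reach-sym (fwd e∈T s∈V t∈V r) = Reach-trans (bwd e∈T s∈V t∈V here) (Reach-sym r)
  Reach-sym (bwd e∈T s∈V t∈V r) = Reach-trans (fwd e∈T s∈V t∈V here) (Reach-sym r)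

  Reach-mono : ∀ {V V′ T T′ u w} → V ⊆ V′ → T ⊆ T′ → Reach Γ V T u w → Reach Γ V′ T′ u w
  Reach-mono V⊆ T⊆ here = here
  Reach-mono V⊆ T⊆ (fwd e∈T s∈V t∈V r) = fwd (T⊆ e∈T) (V⊆ s∈V) (V⊆ t∈V) (Reach-mono V⊆ T⊆ r)
  Reach-mono V⊆ T⊆ (bwd e∈T s∈V t∈V r) = bwd (T⊆ e∈T) (V⊆ s∈V) (V⊆ t∈V) (Reach-mono V⊆ T⊆ r)

  Reach-∈ : ∀ {V T u w} → Reach Γ V T u w → u ∈ V → w ∈ V
  Reach-∈ here u∈V = u∈V
  Reach-∈ (fwd _ _ t∈V _) _ = t∈V
  Reach-∈ (bwd _ s∈V _ _) _ = s∈V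

  Reach-bypass : ∀ {V T} e → Reach Γ V (T - e) (src e) (tgt e) →
    ∀ {u w} → Reach Γ V T u w → Reach Γ V (T - e) u w
  Reach-bypass e detour here = here
  Reach-bypass e detour (fwd {x} x∈T s∈V t∈V r) with x ≟ e
  ... | yes refl = Reach-trans (Reach-bypass e detour r) detour
  ... | no x≢e = fwd (FSP.x∈p∧x≢y⇒x∈p-y x∈T x≢e) s∈V t∈V (Reach-bypass e detour r)
  Reach-bypass e detour (bwd {x} x∈T s∈V t∈V r) with x ≟ e
  ... | yes refl = Reach-trans (Reach-bypass e detour r) (Reach-sym detour)
  ... | no x≢e = bwd (FSP.x∈p∧x≢y⇒x∈p-y x∈T x≢e) s∈V t∈V (Reach-bypass e detour r)

  ∈E⁺ : ∀ {W W′ e} → (src e ∈ W × tgt e ∈ W′) ⊎ (src e ∈ W′ × tgt e ∈ W) → e ∈ E Γ W W′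
  ∈E⁺ {W} {W′} {e} (inj₁ (s∈W , t∈W′)) = ∈-tabulate⁺
    (cong₂ (λ a b → (a ∧ b) ∨ (lookup W′ (src e) ∧ lookup W (tgt e))) (∈⇒lookup s∈W) (∈⇒lookup t∈W′))
  ∈E⁺ {W} {W′} {e} (inj₂ (s∈W′ , t∈W)) = ∈-tabulate⁺ (trans
    (cong₂ (λ a b → (lookup W (src e) ∧ lookup W′ (tgt e)) ∨ (a ∧ b)) (∈⇒lookup s∈W′) (∈⇒lookup t∈W))
    (Bool.∨-zeroʳ _))

  ∈E⁻ : ∀ {W W′ e} → e ∈ E Γ W W′ → (src e ∈ W × tgt e ∈ W′) ⊎ (src e ∈ W′ × tgt e ∈ W)
  ∈E⁻ e∈E = Sum.map ∧-lookup⇒∈ ∧-lookup⇒∈ (∨-true (∈-tabulate⁻ e∈E))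

  EndsIn : Subset n → Subset m → Set
  EndsIn V A = ∀ {x} → x ∈ A → src x ∈ V × tgt x ∈ V

  IsForest : Subset n → Subset m → Set
  IsForest V A = EndsIn V A × (∀ {x} → x ∈ A → ¬ Reach Γ V (A - x) (src x) (tgt x))

  IsForest-restrict : ∀ {V W A B} → IsForest V A → W ⊆ V → B ⊆ A → EndsIn W B → IsForest W B
  IsForest-restrict (_ , bridge) W⊆V B⊆A ends =
    ends , λ x∈B r → bridge (B⊆A x∈B) (Reach-mono W⊆V (p⊆q⇒p-x⊆q-x B⊆A) r)

  module BridgeSplit {V A} (forest : IsForest V A) {x} (x∈A : x ∈ A)
                     (reach? : ∀ v → Dec (Reach Γ V (A - x) (src x) v)) where
    reaches : Fin n → Bool
    reaches v = does (reach? v)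

    X Y : Subset n
    X = tabulate reaches
    Y = tabulate (λ v → lookup V v ∧ not (reaches v))

    AX AY : Subset m
    AX = tabulate (λ y → lookup (A - x) y ∧ reaches (src y))
    AY = tabulate (λ y → lookup (A - x) y ∧ not (reaches (src y)))

    src∈V : src x ∈ V
    src∈V = proj₁ (proj₁ forest x∈A)

    X⊆V : X ⊆ V
    X⊆V {v} v∈X = Reach-∈ (does-true (reach? v) (∈-tabulate⁻ v∈X)) src∈V

    Y⊆V : Y ⊆ V
    Y⊆V = tabulate-∧⊆ (not ∘ reaches)

    ∈Y : ∀ {v} → v ∈ V → ¬ Reach Γ V (A - x) (src x) v → v ∈ Y
    ∈Y {v} v∈V ¬r = ∈-tabulate⁺ (cong₂ (λ a b → a ∧ not b) (∈⇒lookup v∈V) (dec-false (reach? v) ¬r))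

    A-x⊆A : A - x ⊆ A
    A-x⊆A = FSP.p─q⊆p A ⁅ x ⁆

    AX⊆A : AX ⊆ A
    AX⊆A = A-x⊆A ∘ tabulate-∧⊆ (reaches ∘ src)

    AY⊆A : AY ⊆ A
    AY⊆A = A-x⊆A ∘ tabulate-∧⊆ (not ∘ reaches ∘ src)

    AX-ends : EndsIn X AX
    AX-ends {y} y∈AX = src∈X , ∈-tabulate⁺ (dec-true (reach? (tgt y)) (fwd y∈A-x s∈V t∈V reach-src))
      where
      y∈A-x : y ∈ A - x
      y∈A-x = tabulate-∧⊆ (reaches ∘ src) y∈AX
      src∈X : src y ∈ X
      src∈X = ∈-tabulate⁺ (Bool.∧-conicalʳ _ _ (∈-tabulate⁻ y∈AX))
      s∈V : src y ∈ V
      s∈V = proj₁ (proj₁ forest (AX⊆A y∈AX))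
      t∈V : tgt y ∈ V
      t∈V = proj₂ (proj₁ forest (AX⊆A y∈AX))
      reach-src : Reach Γ V (A - x) (src x) (src y)
      reach-src = does-true (reach? (src y)) (∈-tabulate⁻ src∈X)

    AY-ends : EndsIn Y AY
    AY-ends {y} y∈AY = ∈Y s∈V ¬reach-src , ∈Y t∈V (¬reach-src ∘ bwd y∈A-x s∈V t∈V)
      where
      y∈A-x : y ∈ A - x
      y∈A-x = tabulate-∧⊆ (not ∘ reaches ∘ src) y∈AY
      s∈V : src y ∈ V
      s∈V = proj₁ (proj₁ forest (AY⊆A y∈AY))
      t∈V : tgt y ∈ V
      t∈V = proj₂ (proj₁ forest (AY⊆A y∈AY))
      ¬reach-src : ¬ Reach Γ V (A - x) (src x) (src y)
      ¬reach-src r with () ← trans (sym (cong not (dec-true (reach? (src y)) r))) (Bool.∧-conicalʳ _ _ (∈-tabulate⁻ y∈AY))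

    X-forest : IsForest X AX
    X-forest = IsForest-restrict forest X⊆V AX⊆A AX-ends

    Y-forest : IsForest Y AY
    Y-forest = IsForest-restrict forest Y⊆V AY⊆A AY-ends

    X-nonempty : Nonempty X
    X-nonempty = src x , ∈-tabulate⁺ (dec-true (reach? (src x)) here)

    Y-nonempty : Nonempty Y
    Y-nonempty = tgt x , ∈Y (proj₂ (proj₁ forest x∈A)) (proj₂ forest x∈A)

    card-A : card A ≡ suc (card AX ℕ.+ card AY)
    card-A = trans (card-remove x∈A) (cong suc (trans
      (count-split (lookup (A - x)) (reaches ∘ src))
      (sym (cong₂ ℕ._+_ (card-tabulate (λ y → lookup (A - x) y ∧ reaches (src y)))
                        (card-tabulate (λ y → lookup (A - x) y ∧ not (reaches (src y))))))))

    card-V : card V ≡ card X ℕ.+ card Y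
    card-V = trans (count-split (lookup V) reaches) (cong₂ ℕ._+_
      (trans (count-cong λ v → ∧-absorbˡ (lookup V v) (reaches v) (∈⇒lookup ∘ X⊆V ∘ ∈-tabulate⁺))
             (sym (card-tabulate reaches)))
      (sym (card-tabulate (λ v → lookup V v ∧ not (reaches v)))))

  -- Components are found by a classical decision of reachability, hence the double negation;
  -- spanningTree-size removes it since the bound is decidable.
  forest-size-fuel : ∀ k {V A} → card A ℕ.≤ k → IsForest V A → Nonempty V → ¬ ¬ (card A ℕ.< card V)
  forest-size-fuel k {V} {A} A≤k forest (v , v∈V) with any? (λ x → x FSP.∈? A)
  ... | no noEdge = λ ¬goal → ¬goal (subst (ℕ._< card V) (sym noEdges) (count-pos (lookup V) v (∈⇒lookup v∈V)))
    where
    noEdges : card A ≡ 0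
    noEdges = count-none λ x → ∉⇒lookup λ x∈A → noEdge (x , x∈A)
  forest-size-fuel zero {A = A} A≤0 forest _ | yes (x , x∈A)
    with () ← subst (ℕ._≤ 0) (card-remove x∈A) A≤0
  forest-size-fuel (suc k) {V} {A} A≤k forest _ | yes (x , x∈A) = λ ¬goal →
    ¬¬-decideAll _ λ reach? → let open BridgeSplit forest x∈A reach? in
    let AX+AY≤k = ℕP.≤-pred (subst (ℕ._≤ suc k) card-A A≤k) in
    forest-size-fuel k (ℕP.m+n≤o⇒m≤o _ AX+AY≤k) X-forest X-nonempty λ X-bound →
    forest-size-fuel k (ℕP.m+n≤o⇒n≤o _ AX+AY≤k) Y-forest Y-nonempty λ Y-bound →
    ¬goal (subst₂ ℕ._≤_ (cong suc (trans (ℕP.+-suc _ _) (sym card-A))) (sym card-V) (ℕP.+-mono-≤ X-bound Y-bound))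

  spanningTree-size : ∀ {V T} → SpanningTree Γ V T → card T ℕ.< card V
  spanningTree-size {V} {T} (T⊆E , (nonempty , connected) , minimal) =
    decidable-stable (card T ℕP.<? card V) (forest-size-fuel (card T) ℕP.≤-refl (ends , bridge) nonempty)
    where
    ends : EndsIn V T
    ends x∈T = Sum.reduce (∈E⁻ {V} {V} (T⊆E x∈T))
    bridge : ∀ {x} → x ∈ T → ¬ Reach Γ V (T - x) (src x) (tgt x)
    bridge {x} x∈T detour = minimal x x∈T (nonempty , λ u w u∈V w∈V → Reach-bypass x detour (connected u w u∈V w∈V))

  nondisconnecting⊆ : ∀ {W 𝓔ᵢ} → MaxNondisconnecting Γ W 𝓔ᵢ → 𝓔ᵢ ⊆ E Γ W W
  nondisconnecting⊆ {W} (T , _ , refl) = FSP.p─q⊆p (E Γ W W) T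

  inSpanningTree : ∀ {W 𝓔ᵢ e} (max : MaxNondisconnecting Γ W 𝓔ᵢ) → e ∈ E Γ W W → e ∉ 𝓔ᵢ → e ∈ proj₁ max
  inSpanningTree {e = e} (T , _ , refl) e∈E e∉𝓔ᵢ with e FSP.∈? T
  ... | yes e∈T = e∈T
  ... | no e∉T = ⊥-elim (e∉𝓔ᵢ (FSP.x∈p∧x∉q⇒x∈p─q e∈E e∉T))

  Incident : Fin n → Fin m → Set
  Incident v e = src e ≡ v ⊎ tgt e ≡ v

  δW≡∑edgeCut : ∀ 𝓔 Wv We →
    δW Γ 𝓔 Wv We ≡ sum (λ e → edgeCut (lookup 𝓔 e) (lookup Wv (src e)) (lookup Wv (tgt e)) (lookup We e))
  δW≡∑edgeCut 𝓔 Wv We = trans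
    (cong₂ ℕ._+_ (cong₂ ℕ._+_ (count≡∑ cutˢᵗ) (count≡∑ cutˢʷ)) (count≡∑ cutᵗʷ))
    (sym (trans (∑-distrib-+ (λ e → bit (cutˢᵗ e) ℕ.+ bit (cutˢʷ e)) (bit ∘ cutᵗʷ))
                (cong (ℕ._+ sum (bit ∘ cutᵗʷ)) (∑-distrib-+ (bit ∘ cutˢᵗ) (bit ∘ cutˢʷ)))))
    where
    cutˢᵗ cutˢʷ cutᵗʷ : Fin m → Bool
    cutˢᵗ e = not (lookup 𝓔 e) ∧ (lookup Wv (src e) xor lookup Wv (tgt e))
    cutˢʷ e = lookup 𝓔 e ∧ (lookup Wv (src e) xor lookup We e)
    cutᵗʷ e = lookup 𝓔 e ∧ (lookup Wv (tgt e) xor lookup We e)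

  val≡∑ : ∀ v → val Γ v ≡ sum (λ e → bit ⌊ src e ≟ v ⌋ ℕ.+ bit ⌊ tgt e ≟ v ⌋)
  val≡∑ v = trans (cong₂ ℕ._+_ (count≡∑ (λ e → ⌊ src e ≟ v ⌋)) (count≡∑ (λ e → ⌊ tgt e ≟ v ⌋)))
                  (sym (∑-distrib-+ (λ e → bit ⌊ src e ≟ v ⌋) (λ e → bit ⌊ tgt e ≟ v ⌋)))

  δW-vertex≤val : ∀ 𝓔 v → δW Γ 𝓔 ⁅ v ⁆ ∅ ℕ.≤ val Γ v
  δW-vertex≤val 𝓔 v = subst₂ ℕ._≤_ (sym (δW≡∑edgeCut 𝓔 ⁅ v ⁆ ∅)) (sym (val≡∑ v)) (∑-mono edge≤)
    where
    edge≤ : ∀ e → edgeCut (lookup 𝓔 e) (lookup ⁅ v ⁆ (src e)) (lookup ⁅ v ⁆ (tgt e)) (lookup ∅ e)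
                   ℕ.≤ bit ⌊ src e ≟ v ⌋ ℕ.+ bit ⌊ tgt e ≟ v ⌋
    edge≤ e rewrite ∉⇒lookup (FSP.∉⊥ {x = e}) | lookup-⁅⁆ v (src e) | lookup-⁅⁆ v (tgt e) =
      edgeCut-≤ (lookup 𝓔 e) ⌊ src e ≟ v ⌋ ⌊ tgt e ≟ v ⌋

  degW-vertex : ∀ 𝓔 D v → degW Γ 𝓔 D ⁅ v ⁆ ∅ ≡ D v
  degW-vertex 𝓔 D v = trans (cong (λ c → sumℤ (λ u → if lookup ⁅ v ⁆ u then D u else + 0) ℤ.+ + c) card∅≡0)
                            (trans (ℤP.+-identityʳ _) (sumℤ-⁅⁆ D v))
    where
    card∅≡0 : card (∅ {m}) ≡ 0
    card∅≡0 = count-none {m} λ e → ∉⇒lookup (FSP.∉⊥ {x = e})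

  twoμW-vertex : ∀ v → twoμW Γ ⁅ v ⁆ ≡ + val Γ v ℤ.- + 2
  twoμW-vertex = sumℤ-⁅⁆ (λ u → + val Γ u ℤ.- + 2)

  vertexTest≤ : ∀ 𝓔 D v →
    (+ 2 ℤ.* degW Γ 𝓔 D ⁅ v ⁆ ∅) ℤ.- twoμW Γ ⁅ v ⁆ ℤ.+ + δW Γ 𝓔 ⁅ v ⁆ ∅ ℤ.≤ + 2 ℤ.* (D v ℤ.+ + 1)
  vertexTest≤ 𝓔 D v rewrite degW-vertex 𝓔 D v | twoμW-vertex v =
    ℤP.≤-trans (ℤP.+-monoʳ-≤ (+ 2 ℤ.* D v ℤ.- (+ val Γ v ℤ.- + 2)) (+≤+ (δW-vertex≤val 𝓔 v)))
               (ℤP.≤-reflexive (identity (D v) (+ val Γ v)))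
    where
    identity : ∀ d w → (+ 2 ℤ.* d) ℤ.- (w ℤ.- + 2) ℤ.+ w ≡ + 2 ℤ.* (d ℤ.+ + 1)
    identity = solve-∀

  QD-lowerBound : ∀ {v₀ 𝓔 D} → QD Γ v₀ 𝓔 D → ∀ v → + 0 ℤ.≤ addChip D v₀ v
  QD-lowerBound {v₀} {𝓔} {D} (_ , stable) v with v₀ ≟ v | stable ⁅ v ⁆ ∅ (FSP.⊥⊆ {p = 𝓔}) (inj₁ (v , FSP.x∈⁅x⁆ v))
  ... | yes refl | test≥0 , _ =
    ℤP.*-cancelˡ-≤-pos (+ 0) (D v ℤ.+ + 1) (+ 2) (ℤP.≤-trans test≥0 (vertexTest≤ 𝓔 D v))
  ... | no v₀≢v | _ , test>0 = subst (+ 0 ℤ.≤_) (sym (ℤP.+-identityʳ (D v)))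
    (0<i+1⇒0≤i (ℤP.*-cancelˡ-<-nonNeg (+ 2)
      (ℤP.<-≤-trans (test>0 (v₀≢v ∘ FSP.x∈⁅y⁆⇒x≡y v)) (vertexTest≤ 𝓔 D v))))
    where
    0<i+1⇒0≤i : ∀ {i} → + 0 ℤ.< i ℤ.+ + 1 → + 0 ℤ.≤ i
    0<i+1⇒0≤i {+ _} _ = +≤+ z≤n
    0<i+1⇒0≤i { -[1+ zero ]} (+<+ ())
    0<i+1⇒0≤i { -[1+ suc _ ]} ()

  deg-specialise : ∀ {𝓔 f} D p → f ∈ 𝓔 → deg Γ (𝓔 - f) (addChip D p) ≡ deg Γ 𝓔 D
  deg-specialise {𝓔} {f} D p f∈𝓔 = begin
    sumℤ (addChip D p) ℤ.+ + card (𝓔 - f)       ≡⟨ cong (ℤ._+ + card (𝓔 - f)) (sumℤ-+ D (χ p)) ⟩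
    sumℤ D ℤ.+ sumℤ (χ p) ℤ.+ + card (𝓔 - f)    ≡⟨ cong (λ s → sumℤ D ℤ.+ s ℤ.+ + card (𝓔 - f)) (sumℤ-χ p) ⟩
    sumℤ D ℤ.+ + 1 ℤ.+ + card (𝓔 - f)           ≡⟨ ℤP.+-assoc (sumℤ D) (+ 1) _ ⟩
    sumℤ D ℤ.+ + suc (card (𝓔 - f))             ≡⟨ cong (λ c → sumℤ D ℤ.+ + c) (sym (card-remove f∈𝓔)) ⟩
    sumℤ D ℤ.+ + card 𝓔                         ∎
    where open ≡-Reasoning

  -- W with the exceptional vertex v_f added exactly when p ∈ W: moving the chip of v_f to p
  -- then changes neither D(W) nor δ_W.
  attach : Subset n → Fin n → Fin m → Subset m → Subset m
  attach Wv p f We = tabulate (λ e → lookup We e ∨ (⌊ e ≟ f ⌋ ∧ lookup Wv p))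

  lookup-attach-other : ∀ Wv p {f} We {e} → e ≢ f → lookup (attach Wv p f We) e ≡ lookup We e
  lookup-attach-other Wv p {f} We {e} e≢f =
    trans (VP.lookup∘tabulate _ e)
          (trans (cong (λ b → lookup We e ∨ (b ∧ lookup Wv p)) (≟-≢ e≢f)) (Bool.∨-identityʳ _))

  lookup-attach-self : ∀ Wv p {f} {We} → f ∉ We → lookup (attach Wv p f We) f ≡ lookup Wv p
  lookup-attach-self Wv p {f} {We} f∉We =
    trans (VP.lookup∘tabulate _ f) (cong₂ (λ a b → a ∨ (b ∧ lookup Wv p)) (∉⇒lookup f∉We) (≟-refl f))

  degW-addChip : ∀ 𝓔 𝓔′ D Wv p {f} We → f ∉ We →
    degW Γ 𝓔 (addChip D p) Wv We ≡ degW Γ 𝓔′ D Wv (attach Wv p f We)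
  degW-addChip 𝓔 𝓔′ D Wv p {f} We f∉We = begin
    sumℤ (λ v → if lookup Wv v then addChip D p v else + 0) ℤ.+ + card We
      ≡⟨ cong (ℤ._+ + card We) (trans (sumℤ-cong (λ v → split-if (lookup Wv v)))
                                      (sumℤ-+ restricted (λ v → if lookup Wv v then χ p v else + 0))) ⟩
    sumℤ restricted ℤ.+ sumℤ (λ v → if lookup Wv v then χ p v else + 0) ℤ.+ + card We
      ≡⟨ cong (λ s → sumℤ restricted ℤ.+ s ℤ.+ + card We) chip-in-W ⟩
    sumℤ restricted ℤ.+ + bit (lookup Wv p) ℤ.+ + card We
      ≡⟨ ℤP.+-assoc (sumℤ restricted) _ _ ⟩
    sumℤ restricted ℤ.+ (+ bit (lookup Wv p) ℤ.+ + card We)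
      ≡⟨ cong (λ c → sumℤ restricted ℤ.+ + c) (sym card-attach) ⟩
    sumℤ restricted ℤ.+ + card (attach Wv p f We)
      ∎
    where
    open ≡-Reasoning
    restricted : Fin n → ℤ
    restricted v = if lookup Wv v then D v else + 0
    split-if : ∀ b {v} → (if b then addChip D p v else + 0) ≡ (if b then D v else + 0) ℤ.+ (if b then χ p v else + 0)
    split-if true = refl
    split-if false = refl
    chip-in-W : sumℤ (λ v → if lookup Wv v then χ p v else + 0) ≡ + bit (lookup Wv p)
    chip-in-W = trans (sumℤ-concentrated _ p off-p) (trans on-p (sym (+bit (lookup Wv p))))
      where
      off-p : ∀ v → v ≢ p → (if lookup Wv v then χ p v else + 0) ≡ + 0
      off-p v v≢p with lookup Wv v
      ... | true = cong (λ b → if b then + 1 else + 0) (≟-≢ (v≢p ∘ sym))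
      ... | false = refl
      on-p : (if lookup Wv p then χ p p else + 0) ≡ (if lookup Wv p then + 1 else + 0)
      on-p = cong (λ c → if lookup Wv p then c else + 0) (χ-self p)
    card-attach : card (attach Wv p f We) ≡ bit (lookup Wv p) ℕ.+ card We
    card-attach = trans
      (count-insert (lookup We) (lookup (attach Wv p f We)) f
                    (λ e e≢f → sym (lookup-attach-other Wv p We e≢f)) (∉⇒lookup f∉We))
      (trans (cong (λ b → card We ℕ.+ bit b) (lookup-attach-self Wv p f∉We)) (ℕP.+-comm (card We) _))

  δW-specialise : ∀ {𝓔 f p} Wv We → f ∈ 𝓔 → f ∉ We → Incident p f →
    δW Γ (𝓔 - f) Wv We ≡ δW Γ 𝓔 Wv (attach Wv p f We)
  δW-specialise {𝓔} {f} {p} Wv We f∈𝓔 f∉We p-f =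
    trans (δW≡∑edgeCut (𝓔 - f) Wv We) (trans (sum-cong-≗ edge) (sym (δW≡∑edgeCut 𝓔 Wv (attach Wv p f We))))
    where
    at-f : edgeCut (lookup (𝓔 - f) f) (lookup Wv (src f)) (lookup Wv (tgt f)) (lookup We f)
         ≡ edgeCut (lookup 𝓔 f) (lookup Wv (src f)) (lookup Wv (tgt f)) (lookup (attach Wv p f We) f)
    at-f = begin
      edgeCut (lookup (𝓔 - f) f) s t (lookup We f)
        ≡⟨ cong₂ (λ c w → edgeCut c s t w) (lookup-self 𝓔 f) (∉⇒lookup f∉We) ⟩
      edgeCut false s t false
        ≡⟨ edgeCut-subdivide (Sum.map (cong (lookup Wv) ∘ sym) (cong (lookup Wv) ∘ sym) p-f) ⟩
      edgeCut true s t (lookup Wv p)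
        ≡⟨ sym (cong₂ (λ c w → edgeCut c s t w) (∈⇒lookup f∈𝓔) (lookup-attach-self Wv p f∉We)) ⟩
      edgeCut (lookup 𝓔 f) s t (lookup (attach Wv p f We) f) ∎
      where
      open ≡-Reasoning
      s t : Bool
      s = lookup Wv (src f)
      t = lookup Wv (tgt f)

    edge : ∀ e → edgeCut (lookup (𝓔 - f) e) (lookup Wv (src e)) (lookup Wv (tgt e)) (lookup We e)
               ≡ edgeCut (lookup 𝓔 e) (lookup Wv (src e)) (lookup Wv (tgt e)) (lookup (attach Wv p f We) e)
    edge e with e ≟ f
    ... | no e≢f = cong₂ (λ c w → edgeCut c (lookup Wv (src e)) (lookup Wv (tgt e)) w)
                         (lookup-other 𝓔 e≢f) (sym (lookup-attach-other Wv p We e≢f))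
    ... | yes refl = at-f

  QD-specialise : ∀ {v₀ 𝓔 D f p} → QD Γ v₀ 𝓔 D → f ∈ 𝓔 → Incident p f → QD Γ v₀ (𝓔 - f) (addChip D p)
  QD-specialise {v₀} {𝓔} {D} {f} {p} (degree , stable) f∈𝓔 p-f =
    trans (deg-specialise D p f∈𝓔) degree , stable′
    where
    stable′ : ∀ Wv We → We ⊆ 𝓔 - f → Nonempty Wv ⊎ Nonempty We →
      let q = (+ 2 ℤ.* degW Γ (𝓔 - f) (addChip D p) Wv We) ℤ.- twoμW Γ Wv ℤ.+ + δW Γ (𝓔 - f) Wv We in
      (+ 0 ℤ.≤ q) × (v₀ ∉ Wv → + 0 ℤ.< q)
    stable′ Wv We We⊆ nonempty =
      subst (λ q → (+ 0 ℤ.≤ q) × (v₀ ∉ Wv → + 0 ℤ.< q))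
            (sym (cong₂ (λ d δ → (+ 2 ℤ.* d) ℤ.- twoμW Γ Wv ℤ.+ + δ)
                        (degW-addChip (𝓔 - f) 𝓔 D Wv p We f∉We) (δW-specialise Wv We f∈𝓔 f∉We p-f)))
            (stable Wv (attach Wv p f We) attach⊆𝓔 (Sum.map₂ attach-nonempty nonempty))
      where
      f∉We : f ∉ We
      f∉We f∈We = x∉p-x 𝓔 f (We⊆ f∈We)
      attach⊆𝓔 : attach Wv p f We ⊆ 𝓔
      attach⊆𝓔 {e} e∈ with e ≟ f
      ... | yes refl = f∈𝓔
      ... | no e≢f = FSP.p─q⊆p 𝓔 ⁅ f ⁆ (We⊆ (lookup⇒∈ (trans (sym (lookup-attach-other Wv p We e≢f)) (∈⇒lookup e∈))))
      attach-nonempty : Nonempty We → Nonempty (attach Wv p f We)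
      attach-nonempty (e , e∈We) = e , ∈-tabulate⁺ (cong (_∨ (⌊ e ≟ f ⌋ ∧ lookup Wv p)) (∈⇒lookup e∈We))

  ≼-specialise : ∀ {𝓔₀ D₀ 𝓔 D f} (le : _,_≼_,_ Γ 𝓔₀ D₀ 𝓔 D) → f ∈ 𝓔 → f ∉ 𝓔₀ →
    _,_≼_,_ Γ 𝓔₀ D₀ (𝓔 - f) (addChip D (proj₁ (proj₂ le) f))
  ≼-specialise {𝓔₀} {D₀} {𝓔} {D} {f} (𝓔₀⊆𝓔 , φ , φ-incident , D₀≡) f∈𝓔 f∉𝓔₀ =
    𝓔₀⊆𝓔-f , φ , (λ e e∈ → φ-incident e (FSP.p─q⊆p 𝓔 ⁅ f ⁆ e∈)) , D₀≡′
    where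
    𝓔₀⊆𝓔-f : 𝓔₀ ⊆ 𝓔 - f
    𝓔₀⊆𝓔-f e∈ = FSP.x∈p∧x≢y⇒x∈p-y (𝓔₀⊆𝓔 e∈) λ { refl → f∉𝓔₀ e∈ }
    D₀≡′ : ∀ v → D₀ v ≡
      addChip D (φ f) v ℤ.+ + count (λ e → lookup (𝓔 - f) e ∧ not (lookup 𝓔₀ e) ∧ ⌊ φ e ≟ v ⌋)
    D₀≡′ v = begin
      D₀ v                                              ≡⟨ D₀≡ v ⟩
      D v ℤ.+ + count (chipsTo 𝓔)                       ≡⟨ cong (λ c → D v ℤ.+ + c) moved ⟩
      D v ℤ.+ + (rest ℕ.+ bit ⌊ φ f ≟ v ⌋)              ≡⟨ cong (λ x → D v ℤ.+ x) (ℤP.pos-+ rest _) ⟩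
      D v ℤ.+ (+ rest ℤ.+ + bit ⌊ φ f ≟ v ⌋)            ≡⟨ cong (λ x → D v ℤ.+ (+ rest ℤ.+ x)) (+bit _) ⟩
      D v ℤ.+ (+ rest ℤ.+ χ (φ f) v)                    ≡⟨ swap (D v) _ _ ⟩
      addChip D (φ f) v ℤ.+ + rest                      ∎
      where
      open ≡-Reasoning
      chipsTo : Subset m → Fin m → Bool
      chipsTo 𝓔′ e = lookup 𝓔′ e ∧ not (lookup 𝓔₀ e) ∧ ⌊ φ e ≟ v ⌋
      rest : ℕ
      rest = count (chipsTo (𝓔 - f))
      at-f : chipsTo 𝓔 f ≡ ⌊ φ f ≟ v ⌋
      at-f rewrite ∈⇒lookup f∈𝓔 | ∉⇒lookup f∉𝓔₀ = refl
      moved : count (chipsTo 𝓔) ≡ rest ℕ.+ bit ⌊ φ f ≟ v ⌋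
      moved = trans (count-insert (chipsTo (𝓔 - f)) (chipsTo 𝓔) f
                                  (λ e e≢f → cong (_∧ (not (lookup 𝓔₀ e) ∧ ⌊ φ e ≟ v ⌋)) (lookup-other 𝓔 e≢f))
                                  (cong (_∧ (not (lookup 𝓔₀ f) ∧ ⌊ φ f ≟ v ⌋)) (lookup-self 𝓔 f)))
                    (cong (λ b → rest ℕ.+ bit b) at-f)
      swap : ∀ d c x → d ℤ.+ (c ℤ.+ x) ≡ (d ℤ.+ x) ℤ.+ c
      swap = solve-∀

  specialise : ∀ {v₀ 𝓔₀ D₀ 𝓔 D f} → QD Γ v₀ 𝓔 D → _,_≼_,_ Γ 𝓔₀ D₀ 𝓔 D → f ∈ 𝓔 → f ∉ 𝓔₀ →
    ∃ λ p → Incident p f × QD Γ v₀ (𝓔 - f) (addChip D p) × _,_≼_,_ Γ 𝓔₀ D₀ (𝓔 - f) (addChip D p)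
  specialise {𝓔₀ = 𝓔₀} {D₀} {𝓔} {D} {f} qd le f∈𝓔 f∉𝓔₀ =
    φ f , p-f , QD-specialise qd f∈𝓔 p-f , ≼-specialise {𝓔₀} {D₀} {𝓔} {D} le f∈𝓔 f∉𝓔₀
    where
    φ : Fin m → Fin n
    φ = proj₁ (proj₂ le)
    p-f : Incident (φ f) f
    p-f = Sum.map sym sym (proj₁ (proj₂ (proj₂ le)) f f∈𝓔 f∉𝓔₀)

  QD-forced : ∀ {v₀ 𝓔 D} → QD Γ v₀ 𝓔 D → card (∁ 𝓔) ℕ.< n → ∀ v → addChip D v₀ v ≡ + 0
  QD-forced {v₀} {𝓔} {D} qd few =
    sumℤ≤0⇒zero (QD-lowerBound qd) (subst (ℤ._≤ + 0) (sym total) (ℤP.i≤j⇒i-j≤0 (+≤+ few)))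
    where
    c c′ : ℕ
    c = card 𝓔
    c′ = card (∁ 𝓔)
    m≡c+c′ : m ≡ c ℕ.+ c′
    m≡c+c′ = sym (card-∁ 𝓔)
    s+1 : ∀ s c → s ℤ.+ + 1 ≡ (s ℤ.+ c) ℤ.- c ℤ.+ + 1
    s+1 = solve-∀
    collect : ∀ c c′ n → ((c ℤ.+ c′ ℤ.- n ℤ.+ + 1) ℤ.- + 1) ℤ.- c ℤ.+ + 1 ≡ + 1 ℤ.+ c′ ℤ.- n
    collect = solve-∀
    total : sumℤ (addChip D v₀) ≡ + suc c′ ℤ.- + n
    total = begin
      sumℤ (addChip D v₀)                                 ≡⟨ sumℤ-+ D (χ v₀) ⟩
      sumℤ D ℤ.+ sumℤ (χ v₀)                              ≡⟨ cong (λ x → sumℤ D ℤ.+ x) (sumℤ-χ v₀) ⟩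
      sumℤ D ℤ.+ + 1                                      ≡⟨ s+1 (sumℤ D) (+ c) ⟩
      (sumℤ D ℤ.+ + c) ℤ.- + c ℤ.+ + 1                    ≡⟨ cong (λ d → d ℤ.- + c ℤ.+ + 1) (proj₁ qd) ⟩
      ((+ m ℤ.- + n ℤ.+ + 1) ℤ.- + 1) ℤ.- + c ℤ.+ + 1
        ≡⟨ cong (λ k → ((+ k ℤ.- + n ℤ.+ + 1) ℤ.- + 1) ℤ.- + c ℤ.+ + 1) m≡c+c′ ⟩
      ((+ (c ℕ.+ c′) ℤ.- + n ℤ.+ + 1) ℤ.- + 1) ℤ.- + c ℤ.+ + 1
        ≡⟨ cong (λ k → ((k ℤ.- + n ℤ.+ + 1) ℤ.- + 1) ℤ.- + c ℤ.+ + 1) (ℤP.pos-+ c c′) ⟩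
      ((+ c ℤ.+ + c′ ℤ.- + n ℤ.+ + 1) ℤ.- + 1) ℤ.- + c ℤ.+ + 1 ≡⟨ collect (+ c) (+ c′) (+ n) ⟩
      + suc c′ ℤ.- + n                                     ∎
      where open ≡-Reasoning

  Incident? : ∀ v e → Dec (Incident v e)
  Incident? v e = (src e ≟ v) ⊎-dec (tgt e ≟ v)

  Star : Subset m → Fin n → Set
  Star F v = ∀ e → e ∈ F → Incident v e

  PairwiseAdjacent : Subset m → Set
  PairwiseAdjacent F = ∀ {e e′} → e ∈ F → e′ ∈ F → e ≢ e′ → ∃ λ v → Incident v e × Incident v e′

  Crossing : (Fin n → Bool) → Subset m → Set
  Crossing side F = ∀ {e} → e ∈ F → side (src e) ≢ side (tgt e)

  star-or-missed : ∀ F v → Star F v ⊎ ∃ λ e → e ∈ F × ¬ Incident v e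
  star-or-missed F v with all? (λ e → (e FSP.∈? F) →-dec Incident? v e)
  ... | yes star = inj₁ star
  ... | no ¬star with ¬∀⟶∃¬ m _ (λ e → (e FSP.∈? F) →-dec Incident? v e) ¬star
  ...   | e , ¬incident with e FSP.∈? F
  ...     | yes e∈F = inj₂ (e , e∈F , λ v-e → ¬incident λ _ → v-e)
  ...     | no e∉F = ⊥-elim (¬incident λ e∈F → ⊥-elim (e∉F e∈F))

  crossing-ends : ∀ {side F e u w} → Crossing side F → e ∈ F → Incident u e → Incident w e → u ≢ w → side u ≢ side w
  crossing-ends crossing e∈F (inj₁ refl) (inj₁ refl) u≢w = ⊥-elim (u≢w refl)
  crossing-ends crossing e∈F (inj₁ refl) (inj₂ refl) _ = crossing e∈F
  crossing-ends crossing e∈F (inj₂ refl) (inj₁ refl) _ = crossing e∈F ∘ sym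
  crossing-ends crossing e∈F (inj₂ refl) (inj₂ refl) u≢w = ⊥-elim (u≢w refl)

  -- Three pairwise adjacent edges of F, not all through one vertex, would form a triangle,
  -- whose three vertices cannot lie on two sides.
  crossing-triangleFree : ∀ {side F e e′ e″} → Crossing side F → PairwiseAdjacent F →
    e ∈ F → e′ ∈ F → e″ ∈ F → ¬ Incident (src e) e′ → ¬ Incident (tgt e) e″ → ⊥
  crossing-triangleFree {side} {F} {e} {e′} {e″} crossing adjacent e∈F e′∈F e″∈F x∉e′ y∉e″
    with adjacent e∈F e′∈F (λ { refl → x∉e′ (inj₁ refl) }) | adjacent e∈F e″∈F (λ { refl → y∉e″ (inj₂ refl) })
  ... | _ , inj₁ refl , c-e′ | _ = x∉e′ c-e′
  ... | _ , inj₂ _ , _ | _ , inj₂ refl , c-e″ = y∉e″ c-e″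
  ... | _ , inj₂ refl , y∈e′ | _ , inj₁ refl , x∈e″
    with adjacent e′∈F e″∈F (λ { refl → y∉e″ y∈e′ })
  ... | d , d∈e′ , d∈e″ = crossing-ends {side} crossing e″∈F d∈e″ x∈e″ (λ { refl → x∉e′ d∈e′ })
    (≢-≢⇒≡ (crossing-ends {side} crossing e′∈F d∈e′ y∈e′ λ { refl → y∉e″ d∈e″ }) (crossing e∈F ∘ sym))

  pairwiseAdjacent⇒star : ∀ {side F} → Crossing side F → PairwiseAdjacent F → Fin n → ∃ (Star F)
  pairwiseAdjacent⇒star {side} {F} crossing adjacent v with any? (λ e → e FSP.∈? F)
  ... | no noEdge = v , λ e e∈F → ⊥-elim (noEdge (e , e∈F))
  ... | yes (e , e∈F) with star-or-missed F (src e) | star-or-missed F (tgt e)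
  ...   | inj₁ star | _ = src e , star
  ...   | inj₂ _ | inj₁ star = tgt e , star
  ...   | inj₂ (e′ , e′∈F , x∉e′) | inj₂ (e″ , e″∈F , y∉e″) =
    ⊥-elim (crossing-triangleFree {side} crossing adjacent e∈F e′∈F e″∈F x∉e′ y∉e″)

  UniqueQDAbove : Fin n → Subset m → (Fin n → ℤ) → Subset m → Set
  UniqueQDAbove v₀ 𝓔 D 𝓔′ = Σ (Fin n → ℤ) λ D′ →
    (QD Γ v₀ 𝓔′ D′ × _,_≼_,_ Γ 𝓔 D 𝓔′ D′) ×
    (∀ D″ → QD Γ v₀ 𝓔′ D″ → _,_≼_,_ Γ 𝓔 D 𝓔′ D″ → ∀ v → D″ v ≡ D′ v)

-- The cut E(V, Vᶜ)

module Cut {Γ : Graph} {V : Subset (Graph.n Γ)} {𝓔₁ 𝓔₂ : Subset (Graph.m Γ)}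
           (max₁ : MaxNondisconnecting Γ V 𝓔₁) (max₂ : MaxNondisconnecting Γ (∁ V) 𝓔₂) where
  open Graph Γ

  F 𝓔 T₁ T₂ : Subset m
  F = E Γ V (∁ V)
  𝓔 = 𝓔₁ ∪ 𝓔₂
  T₁ = proj₁ max₁
  T₂ = proj₁ max₂

  cut-crossing : Crossing Γ (lookup V) F
  cut-crossing e∈F with ∈E⁻ Γ {V} {∁ V} e∈F
  ... | inj₁ (s∈V , t∈∁V) = λ same →
    case-true (trans (sym (∈⇒lookup s∈V)) (trans same (∈∁⇒lookup t∈∁V)))
  ... | inj₂ (s∈∁V , t∈V) = λ same →
    case-true (trans (sym (∈⇒lookup t∈V)) (trans (sym same) (∈∁⇒lookup s∈∁V)))

  cut-disjoint : ∀ {e} → e ∈ F → e ∉ 𝓔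
  cut-disjoint e∈F e∈𝓔 with FSP.x∈p∪q⁻ 𝓔₁ 𝓔₂ e∈𝓔
  ... | inj₁ e∈𝓔₁ with Sum.reduce (∈E⁻ Γ {V} {V} (nondisconnecting⊆ Γ max₁ e∈𝓔₁))
  ...   | s∈V , t∈V = cut-crossing e∈F (trans (∈⇒lookup s∈V) (sym (∈⇒lookup t∈V)))
  cut-disjoint e∈F e∈𝓔 | inj₂ e∈𝓔₂ with Sum.reduce (∈E⁻ Γ {∁ V} {∁ V} (nondisconnecting⊆ Γ max₂ e∈𝓔₂))
  ...   | s∈∁V , t∈∁V = cut-crossing e∈F (trans (∈∁⇒lookup s∈∁V) (sym (∈∁⇒lookup t∈∁V)))

  cut-uncovered⇒≡ : ∀ {e₀ e} → e ∈ F → e ∉ 𝓔 ∪ (F - e₀) → e ≡ e₀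
  cut-uncovered⇒≡ {e₀} {e} e∈F e∉ with e ≟ e₀
  ... | yes e≡e₀ = e≡e₀
  ... | no e≢e₀ = ⊥-elim (e∉ (FSP.x∈p∪q⁺ (inj₂ (FSP.x∈p∧x≢y⇒x∈p-y e∈F e≢e₀))))

  uncovered⇒∈T₁∪T₂∪⁅e₀⁆ : ∀ e₀ {e} → e ∉ 𝓔 ∪ (F - e₀) → e ∈ T₁ ⊎ e ∈ T₂ ⊎ e ≡ e₀
  uncovered⇒∈T₁∪T₂∪⁅e₀⁆ e₀ {e} e∉ with lookup V (src e) in s∈? | lookup V (tgt e) in t∈?
  ... | true | true = inj₁ (inSpanningTree Γ max₁
    (∈E⁺ Γ {V} {V} (inj₁ (lookup⇒∈ s∈? , lookup⇒∈ t∈?)))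
    (e∉ ∘ FSP.x∈p∪q⁺ ∘ inj₁ ∘ FSP.x∈p∪q⁺ ∘ inj₁))
  ... | false | false = inj₂ (inj₁ (inSpanningTree Γ max₂
    (∈E⁺ Γ {∁ V} {∁ V} (inj₁ (lookup⇒∈∁ s∈? , lookup⇒∈∁ t∈?)))
    (e∉ ∘ FSP.x∈p∪q⁺ ∘ inj₁ ∘ FSP.x∈p∪q⁺ ∘ inj₂)))
  ... | true | false = inj₂ (inj₂ (cut-uncovered⇒≡ (∈E⁺ Γ {V} {∁ V} (inj₁ (lookup⇒∈ s∈? , lookup⇒∈∁ t∈?))) e∉))
  ... | false | true = inj₂ (inj₂ (cut-uncovered⇒≡ (∈E⁺ Γ {V} {∁ V} (inj₂ (lookup⇒∈∁ s∈? , lookup⇒∈ t∈?))) e∉))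

  uncovered-card<n : ∀ e₀ → card (∁ (𝓔 ∪ (F - e₀))) ℕ.< n
  uncovered-card<n e₀ = begin-strict
    card (∁ (𝓔 ∪ (F - e₀)))
      ≤⟨ count-mono classify ⟩
    count (λ e → (lookup T₁ e ∨ lookup T₂ e) ∨ ⌊ e ≟ e₀ ⌋)
      ≤⟨ count-∨ (λ e → lookup T₁ e ∨ lookup T₂ e) _ ⟩
    count (λ e → lookup T₁ e ∨ lookup T₂ e) ℕ.+ count (λ e → ⌊ e ≟ e₀ ⌋)
      ≤⟨ ℕP.+-mono-≤ (count-∨ (lookup T₁) (lookup T₂)) (ℕP.≤-reflexive (count-≟ e₀)) ⟩
    card T₁ ℕ.+ card T₂ ℕ.+ 1
      ≡⟨ trans (ℕP.+-assoc (card T₁) (card T₂) 1) (cong (card T₁ ℕ.+_) (ℕP.+-comm (card T₂) 1)) ⟩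
    card T₁ ℕ.+ suc (card T₂)
      <⟨ ℕP.+-mono-<-≤ (spanningTree-size Γ (proj₁ (proj₂ max₁))) (spanningTree-size Γ (proj₁ (proj₂ max₂))) ⟩
    card V ℕ.+ card (∁ V)
      ≡⟨ card-∁ V ⟩
    n ∎
    where
    open ℕP.≤-Reasoning
    classify : ∀ e → lookup (∁ (𝓔 ∪ (F - e₀))) e ≡ true → ((lookup T₁ e ∨ lookup T₂ e) ∨ ⌊ e ≟ e₀ ⌋) ≡ true
    classify e uncovered? with uncovered⇒∈T₁∪T₂∪⁅e₀⁆ e₀ (FSP.x∈∁p⇒x∉p (lookup⇒∈ uncovered?))
    ... | inj₁ e∈T₁ rewrite ∈⇒lookup e∈T₁ = refl
    ... | inj₂ (inj₁ e∈T₂) rewrite ∈⇒lookup e∈T₂ | Bool.∨-zeroʳ (lookup T₁ e) = refl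
    ... | inj₂ (inj₂ refl) rewrite ≟-refl e = Bool.∨-zeroʳ _

  ∈𝓔∪[F-e] : ∀ {e e′} → e′ ∈ F → e ≢ e′ → e′ ∈ 𝓔 ∪ (F - e)
  ∈𝓔∪[F-e] e′∈F e≢e′ = FSP.x∈p∪q⁺ (inj₂ (FSP.x∈p∧x≢y⇒x∈p-y e′∈F (e≢e′ ∘ sym)))

  F-e-e′⊂F : ∀ {e} e′ → e ∈ F → (F - e) - e′ ⊂ F
  F-e-e′⊂F {e} e′ e∈F = FSP.p─q⊆p F ⁅ e ⁆ ∘ FSP.p─q⊆p (F - e) ⁅ e′ ⁆ ,
                        e , e∈F , x∉p-x F e ∘ FSP.p─q⊆p (F - e) ⁅ e′ ⁆

  cut-pairwiseAdjacent : ∀ {v₀ D} → (∀ S → S ⊂ F → UniqueQDAbove Γ v₀ 𝓔 D (𝓔 ∪ S)) → PairwiseAdjacent Γ F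
  cut-pairwiseAdjacent {v₀} {D} unique {e} {e′} e∈F e′∈F e≢e′
    with unique (F - e) (FSP.x∈p⇒p-x⊂p e∈F) | unique (F - e′) (FSP.x∈p⇒p-x⊂p e′∈F)
       | unique ((F - e) - e′) (F-e-e′⊂F e′ e∈F)
  ... | Dₑ , (qdₑ , leₑ) , _ | Dₑ′ , (qdₑ′ , leₑ′) , _ | D_S , _ , unique-S
    with specialise Γ {D = Dₑ} qdₑ leₑ (∈𝓔∪[F-e] e′∈F e≢e′) (cut-disjoint e′∈F)
       | specialise Γ {D = Dₑ′} qdₑ′ leₑ′ (∈𝓔∪[F-e] e∈F (e≢e′ ∘ sym)) (cut-disjoint e∈F)
  ... | p , p-e′ , qd₁ , le₁ | q , q-e , qd₂ , le₂ = p , subst (λ z → Incident Γ z e) q≡p q-e , p-e′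
    where
    S≡₁ : (𝓔 ∪ (F - e)) - e′ ≡ 𝓔 ∪ ((F - e) - e′)
    S≡₁ = x∉p⇒p∪q-x≡p∪[q-x] (F - e) (cut-disjoint e′∈F)
    S≡₂ : (𝓔 ∪ (F - e′)) - e ≡ 𝓔 ∪ ((F - e) - e′)
    S≡₂ = trans (x∉p⇒p∪q-x≡p∪[q-x] (F - e′) (cut-disjoint e∈F)) (cong (𝓔 ∪_) (FSP.p─x─y≡p─y─x F e′ e))
    unique-S′ : ∀ {𝓔′ D′} → 𝓔′ ≡ 𝓔 ∪ ((F - e) - e′) → QD Γ v₀ 𝓔′ D′ → _,_≼_,_ Γ 𝓔 D 𝓔′ D′ →
                ∀ v → D′ v ≡ D_S v
    unique-S′ refl = unique-S _
    chips-agree : ∀ v → addChip Dₑ p v ≡ addChip Dₑ′ q v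
    chips-agree v = trans (unique-S′ S≡₁ qd₁ le₁ v) (sym (unique-S′ S≡₂ qd₂ le₂ v))
    forced-agree : ∀ v → Dₑ v ≡ Dₑ′ v
    forced-agree v = ∙-cancelʳ (χ v₀ v) (Dₑ v) (Dₑ′ v)
      (trans (QD-forced Γ qdₑ (uncovered-card<n e) v) (sym (QD-forced Γ qdₑ′ (uncovered-card<n e′) v)))
    q≡p : q ≡ p
    q≡p = χ≡1⇒≡ (trans (sym same-chip) (χ-self p))
      where
      same-chip : χ p p ≡ χ q p
      same-chip = ∙-cancelˡ (Dₑ′ p) (χ p p) (χ q p)
                            (trans (cong (ℤ._+ χ p p) (sym (forced-agree p))) (chips-agree p))

lemma5p16 : (Γ : Graph) → Connected Γ →
  (v₀ : Fin (Graph.n Γ)) → (V : Subset (Graph.n Γ)) → Hemisphere Γ V →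
  (𝓔₁ 𝓔₂ : Subset (Graph.m Γ)) →
  MaxNondisconnecting Γ V 𝓔₁ → MaxNondisconnecting Γ (∁ V) 𝓔₂ →
  (D : Fin (Graph.n Γ) → ℤ) → QD Γ v₀ (𝓔₁ ∪ 𝓔₂) D →
  (∀ (S : Subset (Graph.m Γ)) → S ⊂ E Γ V (∁ V) →
     Σ (Fin (Graph.n Γ) → ℤ) λ D_S →
       (QD Γ v₀ ((𝓔₁ ∪ 𝓔₂) ∪ S) D_S × _,_≼_,_ Γ (𝓔₁ ∪ 𝓔₂) D ((𝓔₁ ∪ 𝓔₂) ∪ S) D_S) ×
       (∀ (D' : Fin (Graph.n Γ) → ℤ) →
          QD Γ v₀ ((𝓔₁ ∪ 𝓔₂) ∪ S) D' → _,_≼_,_ Γ (𝓔₁ ∪ 𝓔₂) D ((𝓔₁ ∪ 𝓔₂) ∪ S) D' →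
          ∀ v → D' v ≡ D_S v)) →
  ∃ λ (v₁ : Fin (Graph.n Γ)) →
    ∀ e → e ∈ E Γ V (∁ V) → Graph.src Γ e ≡ v₁ ⊎ Graph.tgt Γ e ≡ v₁
lemma5p16 Γ _ _ V hemisphere _ _ max₁ max₂ _ _ unique =
  pairwiseAdjacent⇒star Γ {lookup V} cut-crossing (cut-pairwiseAdjacent unique) some-vertex
  where
  open Cut max₁ max₂
  some-vertex : Fin (Graph.n Γ)
  some-vertex = proj₁ (proj₁ (proj₁ hemisphere))
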